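{- For all $n\in\mathbb{N}_0$ and all $\mathbf{b}\in\{0,1\}^{\mathbb{N}}$, $$H_{GP}(n,\mathbf{b})\ge\max\{H_{GP}(\lceil\tfrac{n}{2}\rceil,\mathrm{ODD}(\mathbf{b})),\,H_{GP}(\lfloor\tfrac{n}{2}\rfloor,\mathrm{EVEN}(\mathbf{b}))\}.$$
   Context: For an infinite sequence $s=(s_1,s_2,\ldots)$, $\mathrm{ODD}(s)=(s_1,s_3,\ldots)$ and $\mathrm{EVEN}(s)=(s_2,s_4,\ldots)$; $a\mathbf{c}$ denotes the vector with first entry the bit $a$ followed by $\mathbf{c}$. $H_{GP}:\mathbb{N}_0\times\{0,1\}^{\mathbb{N}}\to\mathbb{N}_0$ is defined recursively by $H_{GP}(0,\mathbf{b})=0$ and, for $k>0$, $H_{GP}(k,0\mathbf{c})=1+H_{GP}(k-1,\mathbf{c})$ and $H_{GP}(k,1\mathbf{c})=1+\max\{H_{GP}(\lceil\tfrac{k-1}{2}\rceil,\mathrm{ODD}(\mathbf{c})),\,H_{GP}(\lfloor\tfrac{k-1}{2}\rfloor,\mathrm{EVEN}(\mathbf{c}))\}$. -}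

module Defs where

open import Data.Nat using (ℕ; zero; suc; _+_; _*_; _⊔_; ⌊_/2⌋; ⌈_/2⌉)
open import Data.Bool using (Bool; true; false)

-- An infinite binary sequence b = (b₁, b₂, …) is represented as a function
-- ℕ → Bool with  b i  standing for  b_{i+1}  (0-based indexing).
Seq : Set
Seq = ℕ → Bool

tail : Seq → Seq
tail b i = b (suc i)

-- ODD(s) = (s₁, s₃, …)  (0-based: positions 0, 2, 4, …)
ODD : Seq → Seq
ODD s i = s (2 * i)

-- EVEN(s) = (s₂, s₄, …)  (0-based: positions 1, 3, 5, …)
EVEN : Seq → Seq
EVEN s i = s (suc (2 * i))

-- Fuelled version of H_GP; the fuel only serves to make the recursion
-- structural. Whenever fuel ≥ k the value equals the paper's H_GP(k, b)
-- (each recursive call has argument ≤ k-1, so fuel-1 ≥ it).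
HGP-fuel : ℕ → ℕ → Seq → ℕ
HGP-fuel zero       _       _ = 0
HGP-fuel (suc fuel) zero    _ = 0
HGP-fuel (suc fuel) (suc k) b with b 0
... | false = suc (HGP-fuel fuel k (tail b))
... | true  = suc (HGP-fuel fuel ⌈ k /2⌉ (ODD (tail b))
                   ⊔ HGP-fuel fuel ⌊ k /2⌋ (EVEN (tail b)))

-- H_GP(k, b), with  H_GP(0,b) = 0,
-- H_GP(k, 0c) = 1 + H_GP(k-1, c),
-- H_GP(k, 1c) = 1 + max{H_GP(⌈(k-1)/2⌉, ODD c), H_GP(⌊(k-1)/2⌋, EVEN c)}.
HGP : ℕ → Seq → ℕ
HGP k b = HGP-fuel k k b

module Submission where

-- The theorem is then proved by strong induction on n.  For n = m+1 and
-- b = x c, the key observation is that ODD b = x EVEN(c) and EVEN b = ODD c,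
-- so both halves of split H_GP (m+1) b are controlled by branch x H_GP
-- applied to c: the induction hypotheses for (m, c) and (⌊m/2⌋, EVEN c)
-- bound them by 1 + branch x H_GP m c = H_GP(m+1, b).

open import Defs
open import Data.Nat
  using (ℕ; zero; suc; _+_; _*_; _⊔_; _≤_; _<_; _≥_; z≤n; s≤s; ⌊_/2⌋; ⌈_/2⌉)
open import Data.Nat.Properties
  using (≤-refl; ≤-trans; m≤m⊔n; m≤n⊔m; ⊔-lub; n≤1+n; n<1+n; +-suc; ⌈n/2⌉≤n; ⌊n/2⌋≤n; module ≤-Reasoning)
open import Data.Nat.Induction using (<-rec)
open import Data.Bool using (Bool; true; false)
open import Relation.Binary.PropositionalEquality
  using (_≡_; _≗_; refl; sym; trans; cong; cong₂)

split : (ℕ → Seq → ℕ) → ℕ → Seq → ℕ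
split H k c = H ⌈ k /2⌉ (ODD c) ⊔ H ⌊ k /2⌋ (EVEN c)

-- The recursive part of H(k+1, x c), according to the first bit x.
branch : Bool → (ℕ → Seq → ℕ) → ℕ → Seq → ℕ
branch false H k c = H k c
branch true  H k c = split H k c

HGP-fuel-suc : ∀ f k b →
  HGP-fuel (suc f) (suc k) b ≡ suc (branch (b 0) (HGP-fuel f) k (tail b))
HGP-fuel-suc f k b with b 0
... | false = refl
... | true  = refl

branch-local : ∀ x {H G : ℕ → Seq → ℕ} k c →
  (∀ j → j ≤ k → ∀ d → H j d ≡ G j d) → branch x H k c ≡ branch x G k c
branch-local false k c H≡G = H≡G k ≤-refl c
branch-local true  k c H≡G =
  cong₂ _⊔_ (H≡G _ (⌈n/2⌉≤n k) _) (H≡G _ (⌊n/2⌋≤n k) _)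

branch-cong : ∀ x (H : ℕ → Seq → ℕ) →
  (∀ j {c d} → c ≗ d → H j c ≡ H j d) → ∀ k {c d} → c ≗ d → branch x H k c ≡ branch x H k d
branch-cong false H H-cong k c≗d = H-cong k c≗d
branch-cong true  H H-cong k c≗d =
  cong₂ _⊔_ (H-cong _ (λ i → c≗d (2 * i))) (H-cong _ (λ i → c≗d (suc (2 * i))))

HGP-fuel-zero : ∀ f b → HGP-fuel f 0 b ≡ 0
HGP-fuel-zero zero    b = refl
HGP-fuel-zero (suc f) b = refl

HGP-fuel-irrelevant : ∀ f g k b → k ≤ f → k ≤ g → HGP-fuel f k b ≡ HGP-fuel g k b
HGP-fuel-irrelevant f g zero b _ _ = trans (HGP-fuel-zero f b) (sym (HGP-fuel-zero g b))
HGP-fuel-irrelevant (suc f) (suc g) (suc k) b (s≤s k≤f) (s≤s k≤g) =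
  trans (HGP-fuel-suc f k b)
    (trans (cong suc (branch-local (b 0) k (tail b) fuels-agree))
           (sym (HGP-fuel-suc g k b)))
  where
  fuels-agree : ∀ j → j ≤ k → ∀ d → HGP-fuel f j d ≡ HGP-fuel g j d
  fuels-agree j j≤k d = HGP-fuel-irrelevant f g j d (≤-trans j≤k k≤f) (≤-trans j≤k k≤g)

HGP-fuel-cong : ∀ f k {b c} → b ≗ c → HGP-fuel f k b ≡ HGP-fuel f k c
HGP-fuel-cong zero    k       b≗c = refl
HGP-fuel-cong (suc f) zero    b≗c = refl
HGP-fuel-cong (suc f) (suc k) {b} {c} b≗c =
  trans (HGP-fuel-suc f k b)
    (trans (cong suc (trans (cong (λ x → branch x (HGP-fuel f) k (tail b)) (b≗c 0))
                            (branch-cong (c 0) (HGP-fuel f) (HGP-fuel-cong f) k (λ i → b≗c (suc i)))))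
           (sym (HGP-fuel-suc f k c)))

HGP-cong : ∀ k {b c} → b ≗ c → HGP k b ≡ HGP k c
HGP-cong k = HGP-fuel-cong k k

HGP-suc : ∀ k b → HGP (suc k) b ≡ suc (branch (b 0) HGP k (tail b))
HGP-suc k b =
  trans (HGP-fuel-suc k k b) (cong suc (branch-local (b 0) k (tail b) sufficient))
  where
  sufficient : ∀ j → j ≤ k → ∀ d → HGP-fuel k j d ≡ HGP j d
  sufficient j j≤k d = HGP-fuel-irrelevant k j j d j≤k ≤-refl

tail-ODD : ∀ b → tail (ODD b) ≗ EVEN (tail b)
tail-ODD b i = cong (λ j → b (suc j)) (+-suc i (i + 0))

-- ODD b starts with the same bit as b, followed by EVEN (tail b).
HGP-suc-ODD : ∀ k b → HGP (suc k) (ODD b) ≡ suc (branch (b 0) HGP k (EVEN (tail b)))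
HGP-suc-ODD k b =
  trans (HGP-suc k (ODD b)) (cong suc (branch-cong (b 0) HGP HGP-cong k (tail-ODD b)))

split-≤-HGP-suc : ∀ m b →
  split HGP m (tail b) ≤ HGP m (tail b) →
  split HGP ⌊ m /2⌋ (EVEN (tail b)) ≤ HGP ⌊ m /2⌋ (EVEN (tail b)) →
  split HGP (suc m) b ≤ HGP (suc m) b
split-≤-HGP-suc m b ih-tail ih-even = ⊔-lub odd-half even-half
  where
  open ≤-Reasoning
  c = tail b

  branch-EVEN : ∀ x → branch x HGP ⌊ m /2⌋ (EVEN c) ≤ branch x HGP m c
  branch-EVEN false = ≤-trans (m≤n⊔m _ _) ih-tail
  branch-EVEN true  = ≤-trans ih-even (m≤n⊔m _ _)

  branch-ODD : ∀ x → HGP ⌈ m /2⌉ (ODD c) ≤ branch x HGP m c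
  branch-ODD false = ≤-trans (m≤m⊔n _ _) ih-tail
  branch-ODD true  = m≤m⊔n _ _

  odd-half : HGP (suc ⌊ m /2⌋) (ODD b) ≤ HGP (suc m) b
  odd-half = begin
    HGP (suc ⌊ m /2⌋) (ODD b)              ≡⟨ HGP-suc-ODD ⌊ m /2⌋ b ⟩
    suc (branch (b 0) HGP ⌊ m /2⌋ (EVEN c)) ≤⟨ s≤s (branch-EVEN (b 0)) ⟩
    suc (branch (b 0) HGP m c)              ≡⟨ sym (HGP-suc m b) ⟩
    HGP (suc m) b                           ∎

  -- EVEN b is ODD c by definition.
  even-half : HGP ⌈ m /2⌉ (EVEN b) ≤ HGP (suc m) b
  even-half = begin
    HGP ⌈ m /2⌉ (ODD c)        ≤⟨ branch-ODD (b 0) ⟩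
    branch (b 0) HGP m c       ≤⟨ n≤1+n _ ⟩
    suc (branch (b 0) HGP m c) ≡⟨ sym (HGP-suc m b) ⟩
    HGP (suc m) b              ∎

split-≤-HGP : ∀ n b → split HGP n b ≤ HGP n b
split-≤-HGP = <-rec (λ n → ∀ b → split HGP n b ≤ HGP n b) step
  where
  step : ∀ n → (∀ {m} → m < n → ∀ b → split HGP m b ≤ HGP m b) →
         ∀ b → split HGP n b ≤ HGP n b
  step zero    _   b = z≤n
  step (suc m) rec b = split-≤-HGP-suc m b
    (rec (n<1+n m) (tail b)) (rec (s≤s (⌊n/2⌋≤n m)) (EVEN (tail b)))

lemma11 : (n : ℕ) (b : Seq) →
    HGP n b ≥ (HGP ⌈ n /2⌉ (ODD b) ⊔ HGP ⌊ n /2⌋ (EVEN b))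
lemma11 = split-≤-HGP
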